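{- Let $\psi$ be an orderable string constraint (see context), and let $(\phi_1,d_1),\dots,(\phi_m,d_m)$ be the flow sequence returned by the Marking Algorithm on the set of equational constraints of $\psi$. Build an RCP proof tree with root $\psi$ as follows: process $i=1,\dots,m$ in order; at step $i$, on every open leaf, first apply Intersect so that every variable carries a single regular constraint (a variable without regular constraint is regarded as constrained by $\Sigma^*$), close every leaf on which some variable has empty language, and then apply Fwd-Prop to $\phi_i$ if $d_i=\leftarrow$ and Bwd-Prop to $\phi_i$ if $d_i=\rightarrow$ (on all open leaves); after step $m$ apply Intersect to every variable on each open leaf and apply Close wherever possible. This procedure is sound and complete: if all branches of the resulting tree are closed then $\psi$ is unsatisfiable, and if $\psi$ is unsatisfiable then all branches of the resulting tree are closed.
   Context: Fix a finite alphabet $\Sigma$; string variables take values in $\Sigma^*$. A string constraint is a finite conjunction (equivalently a finite set, called a sequent) of regular constraints $x\in e$ ($e$ a regular expression with language $L(e)$) and equational constraints $x=f(x_1,\dots,x_n)$ with $f:(\Sigma^*)^n\to\Sigma^*$ a string function. It is satisfiable if some assignment of strings to its variables satisfies every conjunct. A function $f$ is forwardable if for all regular $L_1,\dots,L_n$ the image $f(L_1,\dots,L_n)=\{f(w_1,\dots,w_n): w_i\in L_i\}$ is regular and computable from the $L_i$; $f$ is backwardable if for every regular $L$ the preimage $f^{ -1}(L)$ equals a finite union $\bigcup_{i=1}^k L_{i,1}\times\dots\times L_{i,n}$ of products of regular languages (a recognizable relation), computable from $L$. RCP proof system: proof trees of sequents with the root at the bottom; a node has as children the premises of the rule applied to it.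 Rules: Close: a sequent $\Gamma, x\in e_1,\dots,x\in e_n$ with $L(e_1)\cap\dots\cap L(e_n)=\emptyset$ needs no premise (the leaf is closed). Intersect: $\Gamma, x\in e_1,\dots,x\in e_n$ has premise $\Gamma, x\in e$ where $L(e)=\bigcap_i L(e_i)$. Fwd-Prop: $\Gamma, x_1\in e_1,\dots,x_n\in e_n, x=f(x_1,\dots,x_n)$ has premise $\Gamma, x\in e, x=f(x_1,\dots,x_n), x_1\in e_1,\dots,x_n\in e_n$ where $L(e)=f(L(e_1),\dots,L(e_n))$. Bwd-Prop: $\Gamma, x\in e, x=f(x_1,\dots,x_n)$ has the $k$ premises $\Gamma, x\in e, x=f(x_1,\dots,x_n), x_1\in e^i_1,\dots,x_n\in e^i_n$ ($i=1,\dots,k$) where $f^{ -1}(L(e))=\bigcup_{i=1}^k L(e^i_1)\times\dots\times L(e^i_n)$. A proof tree is closed if every leaf is closed by Close. Marking Algorithm on a finite set $Eqs$ of equational constraints: set remaining $:=Eqs$, marked $:=\emptyset$, flow $:=$ empty sequence. Repeat rounds until marked is unchanged by a round; a round: (a) add to marked every variable having exactly one occurrence (counted with multiplicity, on either side) in the equations of remaining; (b) for each $\phi=(x=f(y_1,\dots,y_k))$ in remaining in turn: if $x\in$ marked and $f$ is backwardable, append $(\phi,\rightarrow)$ to flow and remove $\phi$ from remaining; else if $y_1,\dots,y_k\in$ marked and $f$ is forwardable, append $(\phi,\leftarrow)$ to flow and remove $\phi$. Output flow if remaining is empty at the end, otherwise $\bot$. A set of equational constraints is orderable if the algorithm outputs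 a flow sequence; a string constraint is orderable if its set of equational constraints is orderable. -}

module Defs where

open import Data.Nat using (ℕ; zero; suc; _+_; _≟_)
open import Data.Fin using (Fin)
open import Data.Bool using (Bool; true; false; if_then_else_; _∧_; not)
open import Data.List using (List; []; _∷_; _++_; map; length; filterᵇ; concatMap; deduplicate; null)
open import Data.Bool.ListAction using (any; all)
open import Data.Vec using (Vec; lookup; toList)
import Data.Vec as Vec
open import Data.Product using (Σ; _×_; _,_)
open import Data.Maybe using (Maybe; just; nothing)
open import Data.Empty using (⊥)
open import Data.Unit using (⊤)
open import Relation.Nullary using (Dec; ¬_)
open import Relation.Nullary.Decidable using (⌊_⌋; isYes)
open import Relation.Binary.PropositionalEquality using (_≡_)
open import Data.List.Membership.Propositional using (_∈_)

module Strings (k : ℕ) where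

  Word : Set
  Word = List (Fin k)

  data Regex : Set where
    ∅ ε  : Regex
    chr  : Fin k → Regex
    _∪_  : Regex → Regex → Regex
    _·_  : Regex → Regex → Regex
    _⋆   : Regex → Regex

  data _∈ᴸ_ : Word → Regex → Set where
    ε-in   : [] ∈ᴸ ε
    chr-in : ∀ a → (a ∷ []) ∈ᴸ chr a
    ∪-inl  : ∀ {w e f} → w ∈ᴸ e → w ∈ᴸ (e ∪ f)
    ∪-inr  : ∀ {w e f} → w ∈ᴸ f → w ∈ᴸ (e ∪ f)
    ·-in   : ∀ {u v e f} → u ∈ᴸ e → v ∈ᴸ f → (u ++ v) ∈ᴸ (e · f)
    ⋆-nil  : ∀ {e} → [] ∈ᴸ (e ⋆)
    ⋆-cons : ∀ {u v e} → u ∈ᴸ e → v ∈ᴸ (e ⋆) → (u ++ v) ∈ᴸ (e ⋆)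

  Lang : Set₁
  Lang = Word → Set

  ⟦_⟧ : Regex → Lang
  ⟦ e ⟧ w = w ∈ᴸ e

  _≐_ : Lang → Lang → Set
  P ≐ Q = ∀ w → (P w → Q w) × (Q w → P w)

  EmptyL : Regex → Set
  EmptyL e = ∀ w → ¬ (w ∈ᴸ e)

  InProduct : ∀ {n} → Vec Word n → Vec Regex n → Set
  InProduct ws es = ∀ i → lookup ws i ∈ᴸ lookup es i

  Image : (n : ℕ) → (Vec Word n → Word) → Vec Regex n → Lang
  Image n f es w = Σ (Vec Word n) λ ws → InProduct ws es × f ws ≡ w

  PreimageDecomp : ∀ {n} → (Vec Word n → Word) → Regex → (m : ℕ) → (Fin m → Vec Regex n) → Set
  PreimageDecomp f e m D =
    ∀ ws → (f ws ∈ᴸ e → Σ (Fin m) λ i → InProduct ws (D i))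
         × ((Σ (Fin m) λ i → InProduct ws (D i)) → f ws ∈ᴸ e)

  Forwardable : (n : ℕ) → (Vec Word n → Word) → Set
  Forwardable n f = Σ (Vec Regex n → Regex) λ F → ∀ es → ⟦ F es ⟧ ≐ Image n f es

  -- backwardable: preimages of regular languages are recognizable, computably
  Backwardable : (n : ℕ) → (Vec Word n → Word) → Set
  Backwardable n f =
    Σ ((e : Regex) → Σ ℕ λ m → Fin m → Vec Regex n) λ B →
      ∀ e → PreimageDecomp f e (Σ.proj₁ (B e)) (Σ.proj₂ (B e))

  record FunSym : Set where
    field
      arity : ℕ
      fn    : Vec Word arity → Word
      fwd?  : Dec (Forwardable arity fn)
      bwd?  : Dec (Backwardable arity fn)
  open FunSym public

  record EqCon : Set where
    constructor mkEq
    field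
      lhs  : ℕ
      sym  : FunSym
      args : Vec ℕ (arity sym)
  open EqCon public

  RegCon : Set
  RegCon = ℕ × Regex

  record StrCon : Set where
    field
      regs : List RegCon
      eqs  : List EqCon
  open StrCon public

  Sat : StrCon → Set
  Sat ψ = Σ (ℕ → Word) λ σ →
      (∀ {x e} → (x , e) ∈ regs ψ → σ x ∈ᴸ e)
    × (∀ {φ} → φ ∈ eqs ψ → σ (lhs φ) ≡ fn (sym φ) (Vec.map σ (args φ)))

  -- useBwd = (φ , →)  (Bwd-Prop),  useFwd = (φ , ←)  (Fwd-Prop)
  data Dir : Set where
    useBwd useFwd : Dir

  Flow : Set
  Flow = List (EqCon × Dir)

  _∈ᵇ_ : ℕ → List ℕ → Bool
  v ∈ᵇ xs = any (λ y → ⌊ v ≟ y ⌋) xs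

  eqVars : EqCon → List ℕ
  eqVars φ = lhs φ ∷ toList (args φ)

  eqsVars : List EqCon → List ℕ
  eqsVars = concatMap eqVars

  occ : List EqCon → ℕ → ℕ
  occ rs v = length (filterᵇ (λ y → ⌊ v ≟ y ⌋) (eqsVars rs))

  newMarks : List EqCon → List ℕ → List ℕ
  newMarks rem marked =
    deduplicate _≟_ (filterᵇ (λ v → ⌊ occ rem v ≟ 1 ⌋ ∧ not (v ∈ᵇ marked)) (eqsVars rem))

  processB : List ℕ → List EqCon → List EqCon × Flow
  processB m [] = [] , []
  processB m (φ ∷ rs) with processB m rs
  ... | kept , fl =
    if (lhs φ ∈ᵇ m) ∧ isYes (bwd? (sym φ))
    then (kept , (φ , useBwd) ∷ fl)
    else (if all (λ y → y ∈ᵇ m) (toList (args φ)) ∧ isYes (fwd? (sym φ))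
          then (kept , (φ , useFwd) ∷ fl)
          else (φ ∷ kept , fl))

  -- rounds; fuel is only a termination device (it is never exhausted,
  -- since every non-final round marks a new variable of the equations)
  rounds : ℕ → List EqCon → List ℕ → Flow → Maybe Flow
  rounds zero    rem marked flow = nothing
  rounds (suc n) rem marked flow with newMarks rem marked
  ... | new with processB (marked ++ new) rem
  ... | rem' , fl =
    if null new
    then (if null rem' then just (flow ++ fl) else nothing)
    else rounds n rem' (marked ++ new) (flow ++ fl)

  -- output: just flow, or nothing (= ⊥)
  marking : List EqCon → Maybe Flow
  marking es = rounds (suc (length (eqsVars es))) es [] []

  regVars : List RegCon → List ℕ
  regVars = map Σ.proj₁

  varsOf : StrCon → List ℕ
  varsOf ψ = deduplicate _≟_ (regVars (regs ψ) ++ eqsVars (eqs ψ))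

  IntersectTo : List ℕ → List RegCon → (ℕ → Regex) → Set
  IntersectTo V Γ ρ = ∀ v → v ∈ V → ⟦ ρ v ⟧ ≐ (λ w → ∀ e → (v , e) ∈ Γ → w ∈ᴸ e)

  seqOf : List ℕ → (ℕ → Regex) → List RegCon
  seqOf V ρ = map (λ v → (v , ρ v)) V

  SomeEmpty : List ℕ → (ℕ → Regex) → Set
  SomeEmpty V ρ = Σ ℕ λ v → v ∈ V × EmptyL (ρ v)

  NoneEmpty : List ℕ → (ℕ → Regex) → Set
  NoneEmpty V ρ = ∀ v → v ∈ V → ¬ EmptyL (ρ v)

  argCons : ∀ {n} → Vec ℕ n → Vec Regex n → List RegCon
  argCons xs es = toList (Vec.zip xs es)

  -- ProcTree V fl Γ : a tree produced by the procedure from the sequent with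
  -- regular constraints Γ (equations are those of ψ, unchanged), when the
  -- flow entries fl remain to be processed; V = variables of ψ.
  data ProcTree (V : List ℕ) : Flow → List RegCon → Set where
    -- Intersect, then Close (at any step, or at the end)
    closedLeaf : ∀ {fl Γ} (ρ : ℕ → Regex) → IntersectTo V Γ ρ → SomeEmpty V ρ →
                 ProcTree V fl Γ
    -- after the last step: Intersect, nothing closable: open leaf
    openLeaf   : ∀ {Γ} (ρ : ℕ → Regex) → IntersectTo V Γ ρ → NoneEmpty V ρ →
                 ProcTree V [] Γ
    fwdNode    : ∀ {fl Γ φ} (ρ : ℕ → Regex) → IntersectTo V Γ ρ → NoneEmpty V ρ →
                 (e : Regex) → ⟦ e ⟧ ≐ Image (arity (sym φ)) (fn (sym φ)) (Vec.map ρ (args φ)) →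
                 ProcTree V fl ((lhs φ , e) ∷ seqOf V ρ) →
                 ProcTree V ((φ , useFwd) ∷ fl) Γ
    bwdNode    : ∀ {fl Γ φ} (ρ : ℕ → Regex) → IntersectTo V Γ ρ → NoneEmpty V ρ →
                 (m : ℕ) (D : Fin m → Vec Regex (arity (sym φ))) →
                 PreimageDecomp (fn (sym φ)) (ρ (lhs φ)) m D →
                 ((i : Fin m) → ProcTree V fl (argCons (args φ) (D i) ++ seqOf V ρ)) →
                 ProcTree V ((φ , useBwd) ∷ fl) Γ

  AllClosed : ∀ {V fl Γ} → ProcTree V fl Γ → Set
  AllClosed (closedLeaf _ _ _)          = ⊤
  AllClosed (openLeaf _ _ _)            = ⊥
  AllClosed (fwdNode _ _ _ _ _ t)       = AllClosed t
  AllClosed (bwdNode _ _ _ _ _ _ ts)    = ∀ i → AllClosed (ts i)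

{-# OPTIONS --safe #-}
-- Soundness holds for every tree of this shape: a model of ψ satisfies every regular
-- constraint that Intersect, Fwd-Prop and Bwd-Prop add, so it survives along some
-- branch, and no leaf on that branch can be closed.
--
-- Completeness rests on the order computed by the marking algorithm. Equations are
-- only ever removed, so a marked variable keeps occurring at most once in the
-- remaining equations; hence when (φ , d) is processed, its pivots (the left-hand
-- side for Bwd-Prop, the arguments for Fwd-Prop) occur exactly once in φ and the
-- equations processed after it. Models are then pushed from an open leaf down to the
-- root: at an open leaf pick a word in every (nonempty) language; at a Fwd-Prop node
-- reassign the arguments to a preimage of the value of the left-hand side, at a
-- Bwd-Prop node reassign the left-hand side to the image of the arguments. The
-- reassigned variables occur in no other remaining equation, so those stay satisfied.
module Submission where

open import Defs
open import Data.Nat using (ℕ; zero; suc; _+_; _≤_; _≟_)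
open import Data.Nat.Properties using (module ≤-Reasoning; ≤-trans; ≤-reflexive; +-mono-≤; m≤m+n; m≤n+m; 1+n≰n)
open import Data.Fin using (Fin)
import Data.Fin as Fin
open import Data.Bool using (T; true; false; _∧_; not)
open import Data.Bool.ListAction using (all)
open import Data.Bool.Properties using (T-∧; T-≡)
open import Data.List using (List; []; _∷_; _++_; map; length; filterᵇ; concatMap)
open import Data.List.Properties using (filter-++; filter-some; length-++; concatMap-++; map-++; ++-identityʳ; ++-assoc)
open import Data.List.Relation.Unary.Any as Any using (here; there)
open import Data.List.Relation.Unary.Any.Properties using (any⁻)
open import Data.List.Relation.Unary.All.Properties using (All¬⇒¬Any; ¬Any⇒All¬; all⁺)
import Data.List.Relation.Unary.All as All
open import Data.List.Relation.Unary.Unique.Propositional using (Unique; []; _∷_)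
open import Data.List.Membership.Propositional using (_∈_; _∉_)
open import Data.List.Membership.Propositional.Properties
  using (∈-++⁺ˡ; ∈-++⁺ʳ; ∈-++⁻; ∈-concat⁺′; ∈-map⁺; ∈-map⁻; ∈-filter⁻
        ; ∈-deduplicate⁺; ∈-deduplicate⁻)
open import Data.List.Membership.DecPropositional _≟_ using (_∈?_)
open import Data.List.Relation.Binary.Subset.Propositional using (_⊆_)
open import Data.List.Relation.Binary.Permutation.Propositional as ↭
  using (_↭_; ↭-refl; ↭-sym; ↭-trans; prep; swap)
open import Data.List.Relation.Binary.Permutation.Propositional.Properties
  using (↭-length; filter-↭; ++⁺ˡ; shift; shifts; ∈-resp-↭)
open import Data.Vec using (Vec; []; _∷_; lookup; toList; zip)
import Data.Vec as Vec
open import Data.Vec.Properties using (lookup-map; lookup-zip)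
import Data.Vec.Relation.Unary.Any as VecAny
open import Data.Vec.Relation.Unary.Any.Properties using (lookup-index)
open import Data.Vec.Membership.Propositional.Properties using (∈-lookup; ∈-toList⁺; ∈-toList⁻)
open import Data.Product using (∃; _×_; _,_; proj₁; proj₂)
open import Data.Sum using (_⊎_; inj₁; inj₂; [_,_])
open import Data.Maybe using (just)
open import Data.Empty using (⊥-elim)
open import Data.Unit using (⊤; tt)
open import Function using (_∘_; id; const; _⇔_; mk⇔; Equivalence)
open import Relation.Nullary using (¬_; yes; no; contradiction)
open import Relation.Nullary.Decidable using (⌊_⌋; isYes; toWitness; fromWitness)
open import Relation.Binary.PropositionalEquality as ≡ using (_≡_; _≢_; refl; trans; cong; cong₂; subst; subst₂)

open Equivalence using (to; from)

occurrences : ℕ → List ℕ → ℕ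
occurrences v xs = length (filterᵇ (λ y → ⌊ v ≟ y ⌋) xs)

occurrences-++ : ∀ v xs ys → occurrences v (xs ++ ys) ≡ occurrences v xs + occurrences v ys
occurrences-++ v xs ys = trans (cong length (filter-++ _ xs ys)) (length-++ (filterᵇ _ xs))

occurrences-≤-++ˡ : ∀ v xs ys → occurrences v xs ≤ occurrences v (xs ++ ys)
occurrences-≤-++ˡ v xs ys = subst (_ ≤_) (≡.sym (occurrences-++ v xs ys)) (m≤m+n _ _)

occurrences-≤-++ʳ : ∀ v xs ys → occurrences v ys ≤ occurrences v (xs ++ ys)
occurrences-≤-++ʳ v xs ys = subst (_ ≤_) (≡.sym (occurrences-++ v xs ys)) (m≤n+m _ _)

occurrences-∈ : ∀ {v xs} → v ∈ xs → 1 ≤ occurrences v xs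
occurrences-∈ v∈xs = filter-some _ (Any.map (λ { refl → fromWitness refl }) v∈xs)

occurrences-resp-↭ : ∀ v {xs ys} → xs ↭ ys → occurrences v xs ≡ occurrences v ys
occurrences-resp-↭ v xs↭ys = ↭-length (filter-↭ _ xs↭ys)

at-most-once-∉ : ∀ {v} xs ys → v ∈ xs → occurrences v (xs ++ ys) ≤ 1 → v ∉ ys
at-most-once-∉ {v} xs ys v∈xs once v∈ys = 1+n≰n (≤-trans twice once)
  where
  twice : 2 ≤ occurrences v (xs ++ ys)
  twice = subst (2 ≤_) (≡.sym (occurrences-++ v xs ys)) (+-mono-≤ (occurrences-∈ v∈xs) (occurrences-∈ v∈ys))

at-most-once⇒Unique : ∀ {xs} → (∀ {y} → y ∈ xs → occurrences y xs ≤ 1) → Unique xs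
at-most-once⇒Unique {[]}     _    = []
at-most-once⇒Unique {x ∷ xs} once =
  ¬Any⇒All¬ xs (at-most-once-∉ (x ∷ []) xs (here refl) (once (here refl)))
  ∷ at-most-once⇒Unique (λ {y} y∈xs → ≤-trans (occurrences-≤-++ʳ y (x ∷ []) xs) (once (there y∈xs)))

concatMap-↭ : ∀ {a b} {A : Set a} {B : Set b} (f : A → List B) {xs ys} →
              xs ↭ ys → concatMap f xs ↭ concatMap f ys
concatMap-↭ f ↭.refl          = ↭-refl
concatMap-↭ f (prep x p)      = ++⁺ˡ (f x) (concatMap-↭ f p)
concatMap-↭ f (swap x y p)    = ↭-trans (shifts (f x) (f y)) (++⁺ˡ (f y) (++⁺ˡ (f x) (concatMap-↭ f p)))
concatMap-↭ f (↭.trans p q)   = ↭-trans (concatMap-↭ f p) (concatMap-↭ f q)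

module _ {a} {A : Set a} where

  _[_≔_] : (ℕ → A) → ℕ → A → (ℕ → A)
  (σ [ x ≔ w ]) v with v ≟ x
  ... | yes _ = w
  ... | no  _ = σ v

  [≔]-≡ : ∀ σ x w → (σ [ x ≔ w ]) x ≡ w
  [≔]-≡ σ x w with x ≟ x
  ... | yes _   = refl
  ... | no  x≢x = contradiction refl x≢x

  [≔]-≢ : ∀ σ {x} w {v} → v ≢ x → (σ [ x ≔ w ]) v ≡ σ v
  [≔]-≢ σ {x} w {v} v≢x with v ≟ x
  ... | yes v≡x = contradiction v≡x v≢x
  ... | no  _   = refl

  _[_≔*_] : ∀ {n} → (ℕ → A) → Vec ℕ n → Vec A n → (ℕ → A)
  σ [ []     ≔* []     ] = σ
  σ [ x ∷ xs ≔* w ∷ ws ] = (σ [ x ≔ w ]) [ xs ≔* ws ]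

  [≔*]-∉ : ∀ {n} σ (xs : Vec ℕ n) ws {v} → v ∉ toList xs → (σ [ xs ≔* ws ]) v ≡ σ v
  [≔*]-∉ σ []       []       v∉ = refl
  [≔*]-∉ σ (x ∷ xs) (w ∷ ws) v∉ =
    trans ([≔*]-∉ (σ [ x ≔ w ]) xs ws (v∉ ∘ there)) ([≔]-≢ σ w (v∉ ∘ here))

  map-[≔*] : ∀ {n} σ (xs : Vec ℕ n) ws → Unique (toList xs) → Vec.map (σ [ xs ≔* ws ]) xs ≡ ws
  map-[≔*] σ []       []       []               = refl
  map-[≔*] σ (x ∷ xs) (w ∷ ws) (x∉xs ∷ unique) =
    cong₂ _∷_ (trans ([≔*]-∉ (σ [ x ≔ w ]) xs ws (All¬⇒¬Any x∉xs)) ([≔]-≡ σ x w))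
              (map-[≔*] (σ [ x ≔ w ]) xs ws unique)

  lookup-∈-toList : ∀ {n} (xs : Vec A n) i → lookup xs i ∈ toList xs
  lookup-∈-toList xs i = ∈-toList⁺ (∈-lookup i xs)

  ∈-toList⇒lookup : ∀ {n} {xs : Vec A n} {v} → v ∈ toList xs → ∃ λ i → v ≡ lookup xs i
  ∈-toList⇒lookup v∈xs = let p = ∈-toList⁻ v∈xs in VecAny.index p , lookup-index p

map-cong-∈ : ∀ {a b} {A : Set a} {B : Set b} {n} {f g : A → B} (xs : Vec A n) →
             (∀ {v} → v ∈ toList xs → f v ≡ g v) → Vec.map f xs ≡ Vec.map g xs
map-cong-∈ []       agree = refl
map-cong-∈ (x ∷ xs) agree = cong₂ _∷_ (agree (here refl)) (map-cong-∈ xs (agree ∘ there))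

∧≡true⇒Tˡ : ∀ {x y} → x ∧ y ≡ true → T x
∧≡true⇒Tˡ x∧y≡true = proj₁ (to T-∧ (from T-≡ x∧y≡true))

∀⊎∃ : ∀ {p q} {m} {P : Fin m → Set p} {Q : Fin m → Set q} →
      (∀ i → P i ⊎ Q i) → (∀ i → P i) ⊎ ∃ Q
∀⊎∃ {m = zero}  _ = inj₁ λ ()
∀⊎∃ {m = suc m} h with h Fin.zero | ∀⊎∃ (h ∘ Fin.suc)
... | inj₂ q | _            = inj₂ (Fin.zero , q)
... | inj₁ _ | inj₂ (i , q) = inj₂ (Fin.suc i , q)
... | inj₁ p | inj₁ ps      = inj₁ λ { Fin.zero → p ; (Fin.suc i) → ps i }

module MarkingAlgorithm (k : ℕ) where
  open Strings k

  eqsOf : Flow → List EqCon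
  eqsOf = map proj₁

  occ-++ : ∀ Φ Ψ v → occ (Φ ++ Ψ) v ≡ occ Φ v + occ Ψ v
  occ-++ Φ Ψ v = trans (cong (occurrences v) (concatMap-++ eqVars Φ Ψ)) (occurrences-++ v (eqsVars Φ) (eqsVars Ψ))

  occ-resp-↭ : ∀ {Φ Ψ} → Φ ↭ Ψ → ∀ v → occ Φ v ≡ occ Ψ v
  occ-resp-↭ Φ↭Ψ v = occurrences-resp-↭ v (concatMap-↭ eqVars Φ↭Ψ)

  OccurAtMostOnce : List EqCon → List ℕ → Set
  OccurAtMostOnce Φ vs = ∀ {v} → v ∈ vs → occ Φ v ≤ 1

  OccurAtMostOnce-++ : ∀ Φ {vs ws} →
                       OccurAtMostOnce Φ vs → OccurAtMostOnce Φ ws → OccurAtMostOnce Φ (vs ++ ws)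
  OccurAtMostOnce-++ Φ {vs} once₁ once₂ v∈ = [ once₁ , once₂ ] (∈-++⁻ vs v∈)

  OccurAtMostOnce-↭ : ∀ {Φ Ψ} Θ {vs} → Φ ↭ Ψ ++ Θ → OccurAtMostOnce Φ vs → OccurAtMostOnce Θ vs
  OccurAtMostOnce-↭ {Φ} {Ψ} Θ Φ↭ once {v} v∈ =
    ≤-trans (subst (occ Θ v ≤_) (≡.sym (trans (occ-resp-↭ Φ↭ v) (occ-++ Ψ Θ v))) (m≤n+m _ _))
            (once v∈)

  OccurAtMostOnce-∷ : ∀ φ Φ {vs} → OccurAtMostOnce (φ ∷ Φ) vs → OccurAtMostOnce Φ vs
  OccurAtMostOnce-∷ φ Φ once {v} v∈ = ≤-trans (occurrences-≤-++ʳ v (eqVars φ) _) (once v∈)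

  pivots : EqCon × Dir → List ℕ
  pivots (φ , useBwd) = lhs φ ∷ []
  pivots (φ , useFwd) = toList (args φ)

  Orderly : Flow → Set
  Orderly []       = ⊤
  Orderly (s ∷ fl) = OccurAtMostOnce (eqsOf (s ∷ fl)) (pivots s) × Orderly fl

  orderly-++ : ∀ fl {rest} → Orderly rest →
               (∀ {s} → s ∈ fl → OccurAtMostOnce (eqsOf (fl ++ rest)) (pivots s)) → Orderly (fl ++ rest)
  orderly-++ []       ord _    = ord
  orderly-++ (s ∷ fl) {rest} ord once =
    once (here refl) , orderly-++ fl ord λ s′∈fl → OccurAtMostOnce-∷ (proj₁ s) (eqsOf (fl ++ rest)) (once (there s′∈fl))

  bwd-pivot-∉ : ∀ φ Φ → OccurAtMostOnce (φ ∷ Φ) (lhs φ ∷ []) → lhs φ ∉ toList (args φ) ++ eqsVars Φ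
  bwd-pivot-∉ φ Φ once = at-most-once-∉ (lhs φ ∷ []) _ (here refl) (once (here refl))

  fwd-pivots-unique : ∀ φ Φ → OccurAtMostOnce (φ ∷ Φ) (toList (args φ)) → Unique (toList (args φ))
  fwd-pivots-unique φ Φ once = at-most-once⇒Unique λ {y} y∈ → begin
    occurrences y ys                      ≤⟨ occurrences-≤-++ˡ y ys (eqsVars Φ) ⟩
    occurrences y (ys ++ eqsVars Φ)       ≤⟨ occurrences-≤-++ʳ y (lhs φ ∷ []) (ys ++ eqsVars Φ) ⟩
    occurrences y (eqVars φ ++ eqsVars Φ) ≤⟨ once y∈ ⟩
    1                                     ∎
    where
    ys : List ℕ
    ys = toList (args φ)
    open ≤-Reasoning

  fwd-pivots-∌-lhs : ∀ φ Φ → OccurAtMostOnce (φ ∷ Φ) (toList (args φ)) → lhs φ ∉ toList (args φ)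
  fwd-pivots-∌-lhs φ Φ once x∈ = at-most-once-∉ (lhs φ ∷ []) _ (here refl) (once x∈) (∈-++⁺ˡ x∈)

  fwd-pivots-∉ : ∀ φ Φ → OccurAtMostOnce (φ ∷ Φ) (toList (args φ)) →
                 ∀ {y} → y ∈ toList (args φ) → y ∉ eqsVars Φ
  fwd-pivots-∉ φ Φ once y∈ = at-most-once-∉ (eqVars φ) (eqsVars Φ) (there y∈) (once y∈)

  ∈ᵇ⇒∈ : ∀ {v xs} → T (v ∈ᵇ xs) → v ∈ xs
  ∈ᵇ⇒∈ {xs = xs} t = Any.map toWitness (any⁻ _ xs t)

  all-∈ᵇ⇒⊆ : ∀ {xs ys} → T (all (_∈ᵇ xs) ys) → ys ⊆ xs
  all-∈ᵇ⇒⊆ {ys = ys} t = ∈ᵇ⇒∈ ∘ All.lookup (all⁺ _ ys t)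

  RoundSplit : List ℕ → List EqCon → List EqCon × Flow → Set
  RoundSplit m rem (kept , fl) = rem ↭ eqsOf fl ++ kept × (∀ {s} → s ∈ fl → pivots s ⊆ m)

  processB-split : ∀ m rem → RoundSplit m rem (processB m rem)
  processB-split m []       = ↭-refl , λ ()
  processB-split m (φ ∷ rs) with processB m rs | processB-split m rs
  ... | kept , fl | rs↭ , piv with (lhs φ ∈ᵇ m) ∧ isYes (bwd? (sym φ)) in bwd
  ... | true = prep φ rs↭ , λ { (here refl) (here refl) → ∈ᵇ⇒∈ (∧≡true⇒Tˡ bwd) ; (there s∈) → piv s∈ }
  ... | false with all (λ y → y ∈ᵇ m) (toList (args φ)) ∧ isYes (fwd? (sym φ)) in fwd
  ...   | true  = prep φ rs↭ , λ { (here refl) → all-∈ᵇ⇒⊆ (∧≡true⇒Tˡ fwd) ; (there s∈) → piv s∈ }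
  ...   | false = ↭-trans (prep φ rs↭) (↭-sym (shift φ (eqsOf fl) kept)) , piv

  newMarks-once : ∀ rem marked → OccurAtMostOnce rem (newMarks rem marked)
  newMarks-once rem marked {v} v∈new = ≤-reflexive (toWitness {a? = occ rem v ≟ 1} (proj₁ (to T-∧ selected)))
    where
    selected : T (⌊ occ rem v ≟ 1 ⌋ ∧ not (v ∈ᵇ marked))
    selected = proj₂ (∈-filter⁻ _ {xs = eqsVars rem} (∈-deduplicate⁻ _≟_ _ v∈new))

  round-step : ∀ {m rem kept fl rest} → OccurAtMostOnce rem m → RoundSplit m rem (kept , fl) →
               kept ↭ eqsOf rest → Orderly rest → rem ↭ eqsOf (fl ++ rest) × Orderly (fl ++ rest)
  round-step {rem = rem} {kept} {fl} {rest} once (rem↭ , piv) kept↭ ord =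
    rem↭fl++rest , orderly-++ fl ord λ s∈fl {v} v∈ → subst (_≤ 1) (occ-resp-↭ rem↭fl++rest v) (once (piv s∈fl v∈))
    where
    rem↭fl++rest : rem ↭ eqsOf (fl ++ rest)
    rem↭fl++rest = begin
      rem                     ↭⟨ rem↭ ⟩
      eqsOf fl ++ kept        ↭⟨ ++⁺ˡ (eqsOf fl) kept↭ ⟩
      eqsOf fl ++ eqsOf rest  ≡⟨ map-++ proj₁ fl rest ⟨
      eqsOf (fl ++ rest)      ∎
      where open ↭.PermutationReasoning

  rounds-spec : ∀ n {rem marked acc out} → rounds n rem marked acc ≡ just out → OccurAtMostOnce rem marked →
                ∃ λ rest → out ≡ acc ++ rest × rem ↭ eqsOf rest × Orderly rest
  rounds-spec (suc n) {rem} {marked} {acc} eq once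
    with newMarks rem marked | newMarks-once rem marked
  ... | new | new-once
    with processB (marked ++ new) rem | processB-split (marked ++ new) rem
  rounds-spec (suc n) {rem} refl once | [] | _ | [] , fl | split =
    fl ++ [] , cong (_ ++_) (≡.sym (++-identityʳ fl))
             , round-step (OccurAtMostOnce-++ rem once (λ ())) split ↭-refl tt
  rounds-spec (suc n) {rem} {acc = acc} eq once | _ ∷ _ | new-once | kept , fl | split
    with rounds-spec n eq (OccurAtMostOnce-↭ kept (proj₁ split) (OccurAtMostOnce-++ rem once new-once))
  ... | rest , refl , kept↭ , ord =
    fl ++ rest , ++-assoc acc fl rest , round-step (OccurAtMostOnce-++ rem once new-once) split kept↭ ord

  marking-spec : ∀ es {flow} → marking es ≡ just flow → es ↭ eqsOf flow × Orderly flow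
  marking-spec es eq with rounds-spec (suc (length (eqsVars es))) {es} {[]} {[]} eq (λ ())
  ... | rest , refl , es↭ , ord = es↭ , ord

module ProcTreeSemantics (k : ℕ) where
  open Strings k
  open MarkingAlgorithm k

  SatEq : (ℕ → Word) → EqCon → Set
  SatEq σ φ = σ (lhs φ) ≡ fn (sym φ) (Vec.map σ (args φ))

  SatEqs : (ℕ → Word) → List EqCon → Set
  SatEqs σ Φ = ∀ {φ} → φ ∈ Φ → SatEq σ φ

  SatRegsOn : List ℕ → (ℕ → Word) → List RegCon → Set
  SatRegsOn V σ Γ = ∀ {v e} → (v , e) ∈ Γ → v ∈ V → σ v ∈ᴸ e

  Fits : List ℕ → (ℕ → Word) → (ℕ → Regex) → Set
  Fits V σ ρ = ∀ {v} → v ∈ V → σ v ∈ᴸ ρ v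

  Model : List ℕ → List EqCon → List RegCon → (ℕ → Word) → Set
  Model V Φ Γ σ = SatEqs σ Φ × SatRegsOn V σ Γ

  VarsWithin : List ℕ → List EqCon → Set
  VarsWithin V Φ = ∀ {φ} → φ ∈ Φ → eqVars φ ⊆ V

  ∈-eqsVars : ∀ {φ Φ v} → φ ∈ Φ → v ∈ eqVars φ → v ∈ eqsVars Φ
  ∈-eqsVars φ∈Φ v∈φ = ∈-concat⁺′ v∈φ (∈-map⁺ eqVars φ∈Φ)

  SatEq-cong : ∀ {σ τ} φ → (∀ {v} → v ∈ eqVars φ → σ v ≡ τ v) → SatEq σ φ → SatEq τ φ
  SatEq-cong {σ} {τ} φ agree sat = begin
    τ (lhs φ)                        ≡⟨ ≡.sym (agree (here refl)) ⟩
    σ (lhs φ)                        ≡⟨ sat ⟩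
    fn (sym φ) (Vec.map σ (args φ))  ≡⟨ cong (fn (sym φ)) (map-cong-∈ (args φ) (agree ∘ there)) ⟩
    fn (sym φ) (Vec.map τ (args φ))  ∎
    where open ≡.≡-Reasoning

  SatEqs-cong : ∀ {σ τ} Φ → (∀ {v} → v ∈ eqsVars Φ → σ v ≡ τ v) → SatEqs σ Φ → SatEqs τ Φ
  SatEqs-cong Φ agree sat {φ} φ∈Φ = SatEq-cong φ (agree ∘ ∈-eqsVars φ∈Φ) (sat φ∈Φ)

  SatRegsOn⇒Fits : ∀ {V Γ ρ σ} → IntersectTo V Γ ρ → SatRegsOn V σ Γ → Fits V σ ρ
  SatRegsOn⇒Fits {σ = σ} I sat {v} v∈V = proj₂ (I v v∈V (σ v)) (λ e ve∈Γ → sat ve∈Γ v∈V)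

  Fits⇒SatRegsOn : ∀ {V Γ ρ σ} → IntersectTo V Γ ρ → Fits V σ ρ → SatRegsOn V σ Γ
  Fits⇒SatRegsOn {σ = σ} I fits {v} {e} ve∈Γ v∈V = proj₁ (I v v∈V (σ v)) (fits v∈V) e ve∈Γ

  Fits⇒SatRegsOn-seqOf : ∀ {V σ ρ} → Fits V σ ρ → SatRegsOn V σ (seqOf V ρ)
  Fits⇒SatRegsOn-seqOf fits ve∈ v∈V with ∈-map⁻ _ ve∈
  ... | u , u∈V , refl = fits u∈V

  SatRegsOn-seqOf⇒Fits : ∀ {V σ ρ} → SatRegsOn V σ (seqOf V ρ) → Fits V σ ρ
  SatRegsOn-seqOf⇒Fits {ρ = ρ} sat v∈V = sat (∈-map⁺ (λ u → u , ρ u) v∈V) v∈V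

  InProduct-map : ∀ {n} σ ρ (xs : Vec ℕ n) →
                  InProduct (Vec.map σ xs) (Vec.map ρ xs) ⇔ (∀ {v} → v ∈ toList xs → σ v ∈ᴸ ρ v)
  InProduct-map σ ρ xs = mk⇔ pointwise product
    where
    pointwise : InProduct (Vec.map σ xs) (Vec.map ρ xs) → ∀ {v} → v ∈ toList xs → σ v ∈ᴸ ρ v
    pointwise ip v∈xs with ∈-toList⇒lookup v∈xs
    ... | i , refl = subst₂ _∈ᴸ_ (lookup-map i σ xs) (lookup-map i ρ xs) (ip i)
    product : (∀ {v} → v ∈ toList xs → σ v ∈ᴸ ρ v) → InProduct (Vec.map σ xs) (Vec.map ρ xs)
    product fits i =
      subst₂ _∈ᴸ_ (≡.sym (lookup-map i σ xs)) (≡.sym (lookup-map i ρ xs)) (fits (lookup-∈-toList xs i))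

  SatRegsOn-argCons : ∀ {n V σ} (xs : Vec ℕ n) es → toList xs ⊆ V →
                      SatRegsOn V σ (argCons xs es) ⇔ InProduct (Vec.map σ xs) es
  SatRegsOn-argCons {V = V} {σ} xs es xs⊆V = mk⇔ product constraints
    where
    product : SatRegsOn V σ (argCons xs es) → InProduct (Vec.map σ xs) es
    product sat i = subst (_∈ᴸ lookup es i) (≡.sym (lookup-map i σ xs))
      (sat (subst (_∈ argCons xs es) (lookup-zip i xs es) (lookup-∈-toList (zip xs es) i))
           (xs⊆V (lookup-∈-toList xs i)))
    constraints : InProduct (Vec.map σ xs) es → SatRegsOn V σ (argCons xs es)
    constraints ip ve∈ _ with ∈-toList⇒lookup ve∈
    ... | i , ve≡ with trans ve≡ (lookup-zip i xs es)
    ...   | refl = subst (_∈ᴸ lookup es i) (lookup-map i σ xs) (ip i)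

  inhabited-or-empty : (e : Regex) → (∃ λ w → w ∈ᴸ e) ⊎ EmptyL e
  inhabited-or-empty ∅       = inj₂ λ _ ()
  inhabited-or-empty ε       = inj₁ ([] , ε-in)
  inhabited-or-empty (chr a) = inj₁ (a ∷ [] , chr-in a)
  inhabited-or-empty (e ∪ f) with inhabited-or-empty e | inhabited-or-empty f
  ... | inj₁ (w , w∈e) | _              = inj₁ (w , ∪-inl w∈e)
  ... | inj₂ _         | inj₁ (w , w∈f) = inj₁ (w , ∪-inr w∈f)
  ... | inj₂ e-empty   | inj₂ f-empty   =
    inj₂ λ { w (∪-inl w∈e) → e-empty w w∈e ; w (∪-inr w∈f) → f-empty w w∈f }
  inhabited-or-empty (e · f) with inhabited-or-empty e | inhabited-or-empty f
  ... | inj₁ (u , u∈e) | inj₁ (v , v∈f) = inj₁ (u ++ v , ·-in u∈e v∈f)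
  ... | inj₂ e-empty   | _              = inj₂ λ { _ (·-in u∈e _) → e-empty _ u∈e }
  ... | inj₁ _         | inj₂ f-empty   = inj₂ λ { _ (·-in _ v∈f) → f-empty _ v∈f }
  inhabited-or-empty (e ⋆)   = inj₁ ([] , ⋆-nil)

  sample : Regex → Word
  sample e = [ proj₁ , const [] ] (inhabited-or-empty e)

  sample-∈ : ∀ e → ¬ EmptyL e → sample e ∈ᴸ e
  sample-∈ e nonempty with inhabited-or-empty e
  ... | inj₁ (_ , w∈e) = w∈e
  ... | inj₂ empty     = ⊥-elim (nonempty empty)

  fwd-sound : ∀ {V σ ρ φ e} → eqVars φ ⊆ V → SatEq σ φ → Fits V σ ρ →
              ⟦ e ⟧ ≐ Image (arity (sym φ)) (fn (sym φ)) (Vec.map ρ (args φ)) →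
              SatRegsOn V σ ((lhs φ , e) ∷ seqOf V ρ)
  fwd-sound {σ = σ} {ρ} {φ} φ⊆V sat fits e≐image (here refl) _ =
    proj₂ (e≐image _)
      (Vec.map σ (args φ) , from (InProduct-map σ ρ (args φ)) (fits ∘ φ⊆V ∘ there) , ≡.sym sat)
  fwd-sound _ _ fits _ (there ve∈) = Fits⇒SatRegsOn-seqOf fits ve∈

  bwd-sound : ∀ {V σ ρ φ m D} → eqVars φ ⊆ V → SatEq σ φ → Fits V σ ρ →
              PreimageDecomp (fn (sym φ)) (ρ (lhs φ)) m D →
              ∃ λ j → SatRegsOn V σ (argCons (args φ) (D j) ++ seqOf V ρ)
  bwd-sound {σ = σ} {ρ} {φ} {D = D} φ⊆V sat fits decomp
    with proj₁ (decomp (Vec.map σ (args φ))) (subst (_∈ᴸ ρ (lhs φ)) sat (fits (φ⊆V (here refl))))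
  ... | j , ip = j , λ ve∈ → [ from (SatRegsOn-argCons (args φ) (D j) (φ⊆V ∘ there)) ip
                              , Fits⇒SatRegsOn-seqOf fits ] (∈-++⁻ (argCons (args φ) (D j)) ve∈)

  fwd-complete : ∀ {V σ′ ρ φ e Φ} → eqVars φ ⊆ V → OccurAtMostOnce (φ ∷ Φ) (toList (args φ)) →
                 ⟦ e ⟧ ≐ Image (arity (sym φ)) (fn (sym φ)) (Vec.map ρ (args φ)) →
                 SatEqs σ′ Φ → SatRegsOn V σ′ ((lhs φ , e) ∷ seqOf V ρ) →
                 ∃ λ σ → SatEqs σ (φ ∷ Φ) × Fits V σ ρ
  fwd-complete {V} {σ′} {ρ} {φ} {_} {Φ} φ⊆V once e≐image satΦ satΓ = σ , satφΦ , fits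
    where
    ys : Vec ℕ (arity (sym φ))
    ys = args φ
    image : Image (arity (sym φ)) (fn (sym φ)) (Vec.map ρ ys) (σ′ (lhs φ))
    image = proj₁ (e≐image _) (satΓ (here refl) (φ⊆V (here refl)))
    ws : Vec Word (arity (sym φ))
    ws = proj₁ image
    σ : ℕ → Word
    σ = σ′ [ ys ≔* ws ]
    unchanged : ∀ {v} → v ∉ toList ys → σ v ≡ σ′ v
    unchanged = [≔*]-∉ σ′ ys ws
    σ-ys : Vec.map σ ys ≡ ws
    σ-ys = map-[≔*] σ′ ys ws (fwd-pivots-unique φ Φ once)
    satφ : SatEq σ φ
    satφ = begin
      σ (lhs φ)                ≡⟨ unchanged (fwd-pivots-∌-lhs φ Φ once) ⟩
      σ′ (lhs φ)               ≡⟨ ≡.sym (proj₂ (proj₂ image)) ⟩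
      fn (sym φ) ws            ≡⟨ cong (fn (sym φ)) (≡.sym σ-ys) ⟩
      fn (sym φ) (Vec.map σ ys) ∎
      where open ≡.≡-Reasoning
    satφΦ : SatEqs σ (φ ∷ Φ)
    satφΦ (here refl) = satφ
    satφΦ (there φ′∈Φ) =
      SatEqs-cong Φ (λ v∈Φ → ≡.sym (unchanged (λ v∈ys → fwd-pivots-∉ φ Φ once v∈ys v∈Φ))) satΦ φ′∈Φ
    fits : Fits V σ ρ
    fits {v} v∈V with v ∈? toList ys
    ... | yes v∈ys = to (InProduct-map σ ρ ys) σ-ys∈ρ-ys v∈ys
      where
      σ-ys∈ρ-ys : InProduct (Vec.map σ ys) (Vec.map ρ ys)
      σ-ys∈ρ-ys = subst (λ ws → InProduct ws (Vec.map ρ ys)) (≡.sym σ-ys) (proj₁ (proj₂ image))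
    ... | no  v∉ys = subst (_∈ᴸ ρ v) (≡.sym (unchanged v∉ys)) (SatRegsOn-seqOf⇒Fits (satΓ ∘ there) v∈V)

  bwd-complete : ∀ {V σ′ ρ φ m D j Φ} → eqVars φ ⊆ V → OccurAtMostOnce (φ ∷ Φ) (lhs φ ∷ []) →
                 PreimageDecomp (fn (sym φ)) (ρ (lhs φ)) m D →
                 SatEqs σ′ Φ → SatRegsOn V σ′ (argCons (args φ) (D j) ++ seqOf V ρ) →
                 ∃ λ σ → SatEqs σ (φ ∷ Φ) × Fits V σ ρ
  bwd-complete {V} {σ′} {ρ} {φ} {_} {D} {j} {Φ} φ⊆V once decomp satΦ satΓ = σ , satφΦ , fits
    where
    x : ℕ
    x = lhs φ
    ys : Vec ℕ (arity (sym φ))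
    ys = args φ
    x∉ : x ∉ toList ys ++ eqsVars Φ
    x∉ = bwd-pivot-∉ φ Φ once
    fx : Word
    fx = fn (sym φ) (Vec.map σ′ ys)
    fx∈ρx : fx ∈ᴸ ρ x
    fx∈ρx = proj₂ (decomp (Vec.map σ′ ys))
      (j , to (SatRegsOn-argCons ys (D j) (φ⊆V ∘ there)) (λ ve∈ → satΓ (∈-++⁺ˡ ve∈)))
    σ : ℕ → Word
    σ = σ′ [ x ≔ fx ]
    unchanged : ∀ {v} → v ≢ x → σ v ≡ σ′ v
    unchanged = [≔]-≢ σ′ fx
    satφΦ : SatEqs σ (φ ∷ Φ)
    satφΦ (here refl) = begin
      σ x                        ≡⟨ [≔]-≡ σ′ x fx ⟩
      fx                         ≡⟨ cong (fn (sym φ)) (map-cong-∈ ys λ v∈ys →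
                                      ≡.sym (unchanged λ { refl → x∉ (∈-++⁺ˡ v∈ys) })) ⟩
      fn (sym φ) (Vec.map σ ys)  ∎
      where open ≡.≡-Reasoning
    satφΦ (there φ′∈Φ) =
      SatEqs-cong Φ (λ v∈Φ → ≡.sym (unchanged λ { refl → x∉ (∈-++⁺ʳ (toList ys) v∈Φ) })) satΦ φ′∈Φ
    fits : Fits V σ ρ
    fits {v} v∈V with v ≟ x
    ... | yes refl = fx∈ρx
    ... | no  _    = SatRegsOn-seqOf⇒Fits (λ ve∈ → satΓ (∈-++⁺ʳ _ ve∈)) v∈V

  intersect-model : ∀ {V Γ ρ Φ} → IntersectTo V Γ ρ →
                    (∃ λ σ → SatEqs σ Φ × Fits V σ ρ) → ∃ (Model V Φ Γ)
  intersect-model I (σ , sat , fits) = σ , sat , Fits⇒SatRegsOn I fits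

  sound : ∀ {V fl Γ σ} (T : ProcTree V fl Γ) → VarsWithin V (eqsOf fl) →
          Model V (eqsOf fl) Γ σ → ¬ AllClosed T
  sound (closedLeaf ρ I (v , v∈V , empty)) _ (_ , satΓ) _ = empty _ (SatRegsOn⇒Fits I satΓ v∈V)
  sound (openLeaf _ _ _) _ _ ()
  sound (fwdNode {φ = φ} ρ I _ e e≐image T) within (satEqs , satΓ) closed =
    sound T (within ∘ there)
      ( satEqs ∘ there
      , fwd-sound {φ = φ} (within (here refl)) (satEqs (here refl)) (SatRegsOn⇒Fits I satΓ) e≐image)
      closed
  sound (bwdNode {φ = φ} ρ I _ m D decomp ts) within (satEqs , satΓ) closed
    with bwd-sound {φ = φ} {D = D} (within (here refl)) (satEqs (here refl)) (SatRegsOn⇒Fits I satΓ) decomp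
  ... | j , satΓj = sound (ts j) (within ∘ there) (satEqs ∘ there , satΓj) (closed j)

  complete : ∀ {V fl Γ} (T : ProcTree V fl Γ) → VarsWithin V (eqsOf fl) → Orderly fl →
             AllClosed T ⊎ ∃ (Model V (eqsOf fl) Γ)
  complete (closedLeaf _ _ _) _ _ = inj₁ tt
  complete (openLeaf ρ I nonempty) _ _ =
    inj₂ (intersect-model I ((λ v → sample (ρ v)) , (λ ()) , λ v∈V → sample-∈ (ρ _) (nonempty _ v∈V)))
  complete (fwdNode ρ I _ e e≐image T) within (once , ord) with complete T (within ∘ there) ord
  ... | inj₁ closed = inj₁ closed
  ... | inj₂ (_ , satΦ , satΓ) =
    inj₂ (intersect-model I (fwd-complete (within (here refl)) once e≐image satΦ satΓ))
  complete (bwdNode ρ I _ m D decomp ts) within (once , ord)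
    with ∀⊎∃ (λ j → complete (ts j) (within ∘ there) ord)
  ... | inj₁ closed = inj₁ closed
  ... | inj₂ (j , _ , satΦ , satΓ) =
    inj₂ (intersect-model I (bwd-complete {D = D} {j} (within (here refl)) once decomp satΦ satΓ))

  Sat⇔Model : ∀ ψ {Φ} → eqs ψ ↭ Φ → Sat ψ ⇔ ∃ (Model (varsOf ψ) Φ (regs ψ))
  Sat⇔Model ψ eqs↭Φ = mk⇔
    (λ (σ , satRegs , satEqs) → σ , (satEqs ∘ ∈-resp-↭ (↭-sym eqs↭Φ)) , λ ve∈ _ → satRegs ve∈)
    (λ (σ , satEqs , satRegs) → σ , (λ ve∈ → satRegs ve∈ (∈-deduplicate⁺ _≟_ (∈-++⁺ˡ (∈-map⁺ proj₁ ve∈))))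
                                  , satEqs ∘ ∈-resp-↭ eqs↭Φ)

  VarsWithin-varsOf : ∀ ψ {Φ} → eqs ψ ↭ Φ → VarsWithin (varsOf ψ) Φ
  VarsWithin-varsOf ψ eqs↭Φ φ∈Φ v∈φ =
    ∈-deduplicate⁺ _≟_ (∈-++⁺ʳ (regVars (regs ψ)) (∈-eqsVars (∈-resp-↭ (↭-sym eqs↭Φ) φ∈Φ) v∈φ))

theorem1 : (k : ℕ) → let open Strings k in
    (ψ : StrCon) → Unique (eqs ψ) →
    (flow : Flow) → marking (eqs ψ) ≡ just flow →
    (T : ProcTree (varsOf ψ) flow (regs ψ)) →
    (AllClosed T → ¬ Sat ψ) × (¬ Sat ψ → AllClosed T)
theorem1 k ψ _ flow marked T = soundness , completeness
  where
  open Strings k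
  open MarkingAlgorithm k
  open ProcTreeSemantics k

  eqs↭flow : eqs ψ ↭ eqsOf flow
  eqs↭flow = proj₁ (marking-spec (eqs ψ) marked)

  within : VarsWithin (varsOf ψ) (eqsOf flow)
  within = VarsWithin-varsOf ψ eqs↭flow

  soundness : AllClosed T → ¬ Sat ψ
  soundness closed sat = sound T within (proj₂ (to (Sat⇔Model ψ eqs↭flow) sat)) closed

  completeness : ¬ Sat ψ → AllClosed T
  completeness unsat = [ id , ⊥-elim ∘ unsat ∘ from (Sat⇔Model ψ eqs↭flow) ] (complete T within orderly)
    where
    orderly : Orderly flow
    orderly = proj₂ (marking-spec (eqs ψ) marked)
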